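{- Every (finite) tree $G$ is average hereditary.
   Context: All graphs are finite, simple and undirected. The average degree of a graph $H$ is $d(H)=\frac{2|E(H)|}{|V(H)|}$ if $V(H)\neq\emptyset$ and $d(H)=0$ for the null graph. A graph $G$ is called average hereditary if for every induced subgraph $H$ of $G$ one has $d(H)\le d(G)$. -}

module Defs where

open import Data.Nat using (ℕ; zero; suc; _+_; _*_; _≤_; _<ᵇ_)
open import Data.Bool using (Bool; true; false; if_then_else_; _∧_)
open import Data.Fin using (Fin; toℕ)
open import Data.Fin.Subset using (Subset; inside; outside; ⊤) renaming (∣_∣ to size)
open import Data.Vec using (lookup)
open import Data.List using (List; []; _∷_; length; map; allFin; _∷ʳ_)
open import Data.Nat.ListAction using (sum)
open import Data.List.Relation.Unary.Linked using (Linked)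
open import Data.List.Relation.Unary.Unique.Propositional using (Unique)
open import Data.Integer using (+_)
open import Data.Rational using (ℚ; 0ℚ; _/_)
open import Data.Product using (Σ; _×_)
open import Relation.Binary.PropositionalEquality using (_≡_)
open import Relation.Nullary using (¬_)

record Graph (n : ℕ) : Set where
  field
    adj    : Fin n → Fin n → Bool
    sym    : ∀ i j → adj i j ≡ adj j i
    irrefl : ∀ i → adj i i ≡ false
open Graph public

module _ {n : ℕ} where

  Adj : Graph n → Fin n → Fin n → Set
  Adj G u v = adj G u v ≡ true

  mem : Subset n → Fin n → Bool
  mem S i with lookup S i
  ... | inside  = true
  ... | outside = false

  -- number of edges of the induced subgraph G[S]:
  -- unordered pairs {i,j} (counted once via toℕ i < toℕ j) with i,j ∈ S adjacent
  edgesIn : Graph n → Subset n → ℕ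
  edgesIn G S =
    sum (map (λ i → sum (map (λ j →
      if (toℕ i <ᵇ toℕ j) ∧ mem S i ∧ mem S j ∧ adj G i j then 1 else 0)
      (allFin n))) (allFin n))

-- a / b as a rational, with the convention 0 when b = 0
frac : ℕ → ℕ → ℚ
frac a zero    = 0ℚ
frac a (suc k) = (+ a) / suc k

module _ {n : ℕ} where

  -- average degree of the induced subgraph G[S]:
  -- 2|E(G[S])| / |S|, and 0 for the null graph (S = ∅)
  avgDegInduced : Graph n → Subset n → ℚ
  avgDegInduced G S = frac (2 * edgesIn G S) (size S)

  avgDeg : Graph n → ℚ
  avgDeg G = avgDegInduced G ⊤

  AverageHereditary : Graph n → Set
  AverageHereditary G = ∀ (S : Subset n) → avgDegInduced G S Data.Rational.≤ avgDeg G

  data Walk (G : Graph n) : Fin n → Fin n → Set where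
    here : ∀ {u} → Walk G u u
    step : ∀ {u v w} → Adj G u v → Walk G v w → Walk G u w

  Connected : Graph n → Set
  Connected G = ∀ u v → Walk G u v

  IsCycle : Graph n → Fin n → List (Fin n) → Set
  IsCycle G v ws =
    (3 ≤ length (v ∷ ws)) × Unique (v ∷ ws) × Linked (Adj G) ((v ∷ ws) ∷ʳ v)

  Acyclic : Graph n → Set
  Acyclic G = ∀ v ws → ¬ IsCycle G v ws

  IsTree : Graph n → Set
  IsTree G = (1 ≤ n) × Connected G × Acyclic G

-- An induced subgraph H of a tree G is a forest, so if it has k ≥ 1 vertices it has at most
-- k − 1 edges: a nonempty vertex set of an acyclic graph contains a vertex with at most one
-- neighbour in it (the head of a path that cannot be extended), and deleting it loses at most
-- one edge. Conversely G is connected, so it has at least n − 1 edges: growing a vertex set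
-- from a single vertex, some edge always leaves the set, and adding its outer endpoint gains
-- at least one edge. Hence d(H) ≤ 2(k − 1)/k ≤ 2(n − 1)/n ≤ d(G), as k ≤ n.

module Submission where

open import Data.Bool using (Bool; true; false; not; _∧_; _xor_; if_then_else_)
import Data.Bool as Bool
open import Data.Bool.Properties
  using (∧-zeroʳ; ∧-identityʳ; ∧-conicalˡ; ∧-conicalʳ; ¬-not; not-involutive)
open import Data.Empty using (⊥-elim)
open import Data.Fin using (Fin; zero; suc; toℕ; _≟_; punchIn; fromℕ<)
open import Data.Fin.Properties using (punchInᵢ≢i; any?; toℕ-injective)
open import Data.Fin.Subset using (Subset; ⊤; ∣_∣)
open import Data.Fin.Subset.Properties using (∣p∣≤n; ∣⊤∣≡n)
import Data.Integer as ℤ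
import Data.Integer.Properties as ℤ
open import Data.List using (List; []; _∷_; _∷ʳ_; length; map; tabulate; allFin)
open import Data.List.Properties using (map-tabulate)
open import Data.List.Membership.Propositional using (_∈_; _∉_)
open import Data.List.Relation.Unary.All using (All; []; _∷_)
open import Data.List.Relation.Unary.All.Properties using (¬Any⇒All¬)
open import Data.List.Relation.Unary.AllPairs using ([]; _∷_)
open import Data.List.Relation.Unary.Any using (here; there)
open import Data.List.Relation.Unary.Linked using (Linked; []; [-]; _∷_)
open import Data.List.Relation.Unary.Unique.Propositional using (Unique)
open import Data.Nat using (ℕ; zero; suc; _+_; _*_; _∸_; _≤_; _<_; _<ᵇ_; z≤n; s≤s; s≤s⁻¹)
open import Data.Nat.ListAction using () renaming (sum to listSum)
open import Data.Nat.Properties hiding (_≟_)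
open import Data.Product using (∃-syntax; _×_; _,_)
open import Data.Rational as ℚ using (fromℚᵘ)
open import Data.Rational.Properties as ℚ using (toℚᵘ-cancel-≤; toℚᵘ-fromℚᵘ)
open import Data.Rational.Unnormalised as ℚᵘ using (mkℚᵘ)
import Data.Rational.Unnormalised.Properties as ℚᵘ
open import Data.Sum using (_⊎_; inj₁; inj₂)
open import Data.Vec using ([]; _∷_; lookup)
open import Data.Vec.Properties using (lookup-replicate)
open import Data.Vec.Functional using (removeAt; updateAt)
open import Data.Vec.Functional.Properties using (updateAt-updates; updateAt-minimal)
open import Function using (_∘_; id)
open import Relation.Binary.PropositionalEquality
open import Relation.Nullary using (yes; no; does; ofʸ; ofⁿ; contradiction)
open import Relation.Nullary.Decidable using (dec-true; dec-false; decidable-stable; _×-dec_; ¬?)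

open import Defs renaming (sym to adj-sym)

open import Algebra.Properties.CommutativeMonoid.Sum +-0-commutativeMonoid
  using (sum; sum-cong-≗; sum-remove; ∑-comm; ∑-distrib-+)
open import Algebra.Properties.CommutativeSemigroup +-commutativeSemigroup
  using (x∙yz≈y∙xz)

𝟙 : Bool → ℕ
𝟙 true  = 1
𝟙 false = 0

𝟙≤1 : ∀ b → 𝟙 b ≤ 1
𝟙≤1 true  = ≤-refl
𝟙≤1 false = z≤n

𝟙-∧-≤ : ∀ b c → 𝟙 (b ∧ c) ≤ 𝟙 b
𝟙-∧-≤ true  c = 𝟙≤1 c
𝟙-∧-≤ false c = z≤n

𝟙-∧-xor : ∀ p q b → (b ≡ true → p xor q ≡ true) → 𝟙 (p ∧ b) + 𝟙 (q ∧ b) ≡ 𝟙 b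
𝟙-∧-xor p q false _ rewrite ∧-zeroʳ p | ∧-zeroʳ q = refl
𝟙-∧-xor p q true one-of rewrite ∧-identityʳ p | ∧-identityʳ q with p | q | one-of refl
... | true  | false | _ = refl
... | false | true  | _ = refl

<ᵇ-xor : ∀ {m n} → m ≢ n → (m <ᵇ n) xor (n <ᵇ m) ≡ true
<ᵇ-xor {m} {n} m≢n with m <ᵇ n | <ᵇ-reflects-< m n | n <ᵇ m | <ᵇ-reflects-< n m
... | true  | ofʸ m<n | true  | ofʸ n<m = contradiction n<m (<⇒≯ m<n)
... | true  | _       | false | _       = refl
... | false | _       | true  | _       = refl
... | false | ofⁿ m≮n | false | ofⁿ n≮m = contradiction (≤-antisym (≮⇒≥ n≮m) (≮⇒≥ m≮n)) m≢n

m∸1+n≤m : ∀ {m n} → n ≤ m → n ≤ 1 → m ∸ 1 + n ≤ m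
m∸1+n≤m {zero}  z≤n _   = z≤n
m∸1+n≤m {suc m} _   n≤1 = ≤-trans (+-monoʳ-≤ m n≤1) (≤-reflexive (+-comm m 1))

sum-mono-≤ : ∀ {n} {f g : Fin n → ℕ} → (∀ i → f i ≤ g i) → sum f ≤ sum g
sum-mono-≤ {zero}  f≤g = z≤n
sum-mono-≤ {suc n} f≤g = +-mono-≤ (f≤g zero) (sum-mono-≤ (f≤g ∘ suc))

sum-zero : ∀ {n} {f : Fin n → ℕ} → (∀ i → f i ≡ 0) → sum f ≡ 0
sum-zero {zero}  f≡0 = refl
sum-zero {suc n} f≡0 = cong₂ _+_ (f≡0 zero) (sum-zero (f≡0 ∘ suc))

≤-sum : ∀ {n} (f : Fin n → ℕ) v → f v ≤ sum f
≤-sum {suc n} f v = ≤-trans (m≤m+n (f v) _) (≤-reflexive (sym (sum-remove {i = v} f)))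

sum-update : ∀ {n} {f g : Fin n → ℕ} v → (∀ i → i ≢ v → f i ≡ g i) →
             f v + sum g ≡ g v + sum f
sum-update {suc n} {f} {g} v f≡g = begin
  f v + sum g                         ≡⟨ cong (f v +_) (sum-remove {i = v} g) ⟩
  f v + (g v + sum (removeAt g v))    ≡⟨ x∙yz≈y∙xz (f v) (g v) _ ⟩
  g v + (f v + sum (removeAt g v))    ≡⟨ cong (λ s → g v + (f v + s)) removed-agree ⟨
  g v + (f v + sum (removeAt f v))    ≡⟨ cong (g v +_) (sum-remove {i = v} f) ⟨
  g v + sum f                         ∎
  where
  open ≡-Reasoning
  removed-agree : sum (removeAt f v) ≡ sum (removeAt g v)
  removed-agree = sum-cong-≗ (λ i → f≡g (punchIn v i) (punchInᵢ≢i v i))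

sum-at : ∀ {n} {f : Fin n → ℕ} v → (∀ i → i ≢ v → f i ≡ 0) → sum f ≡ f v
sum-at {n} {f} v f≡0 = begin
  sum f                   ≡⟨ sum-update v f≡0 ⟨
  f v + sum {n} (λ _ → 0) ≡⟨ cong (f v +_) (sum-zero {n} (λ _ → refl)) ⟩
  f v + 0                 ≡⟨ +-identityʳ (f v) ⟩
  f v                     ∎
  where open ≡-Reasoning

sum-δ : ∀ {n} (v : Fin n) (b : Fin n → Bool) → sum (λ i → 𝟙 (does (i ≟ v) ∧ b i)) ≡ 𝟙 (b v)
sum-δ v b = trans (sum-at v off-v) (cong (λ d → 𝟙 (d ∧ b v)) (dec-true (v ≟ v) refl))
  where
  off-v : ∀ i → i ≢ v → 𝟙 (does (i ≟ v) ∧ b i) ≡ 0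
  off-v i i≢v rewrite dec-false (i ≟ v) i≢v = refl

∑∑-distrib-+ : ∀ {m n} (f g : Fin m → Fin n → ℕ) →
               sum (λ i → sum (λ j → f i j + g i j)) ≡ sum (λ i → sum (f i)) + sum (λ i → sum (g i))
∑∑-distrib-+ f g =
  trans (sum-cong-≗ (λ i → ∑-distrib-+ (f i) (g i))) (∑-distrib-+ (λ i → sum (f i)) (λ i → sum (g i)))

listSum-tabulate : ∀ {n} (f : Fin n → ℕ) → listSum (tabulate f) ≡ sum f
listSum-tabulate {zero}  f = refl
listSum-tabulate {suc n} f = cong (f zero +_) (listSum-tabulate (f ∘ suc))

listSum-allFin : ∀ {n} (f : Fin n → ℕ) → listSum (map f (allFin n)) ≡ sum f
listSum-allFin f = trans (cong listSum (map-tabulate id f)) (listSum-tabulate f)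

card : ∀ {n} → (Fin n → Bool) → ℕ
card X = sum (𝟙 ∘ X)

card-≤ : ∀ {n} (X : Fin n → Bool) → card X ≤ n
card-≤ {zero}  X = z≤n
card-≤ {suc n} X = +-mono-≤ (𝟙≤1 (X zero)) (card-≤ (X ∘ suc))

card-all-true : ∀ {n} {X : Fin n → Bool} → (∀ i → X i ≡ true) → card X ≡ n
card-all-true {zero}  _ = refl
card-all-true {suc n} X≡true rewrite X≡true zero = cong suc (card-all-true (X≡true ∘ suc))

constant-or-witness : ∀ {n} (X : Fin n → Bool) b → (∀ i → X i ≡ b) ⊎ ∃[ w ] X w ≡ not b
constant-or-witness X b with any? (λ w → X w Bool.≟ not b)
... | yes witness = inj₂ witness
... | no ∄witness = inj₁ λ i → trans (¬-not λ Xi≡¬b → ∄witness (i , Xi≡¬b)) (not-involutive b)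

record Insertion {n} (X : Fin n → Bool) (v : Fin n) (Y : Fin n → Bool) : Set where
  field
    absent  : X v ≡ false
    present : Y v ≡ true
    agree   : ∀ i → i ≢ v → Y i ≡ X i

  ⊆-insertion : ∀ {i} → X i ≡ true → Y i ≡ true
  ⊆-insertion {i} Xi with i ≟ v
  ... | yes refl = present
  ... | no i≢v   = trans (agree i i≢v) Xi

open Insertion

insertion : ∀ {n} {X : Fin n → Bool} {v} → X v ≡ false → Insertion X v (updateAt X v (λ _ → true))
insertion {X = X} {v} Xv = record
  { absent  = Xv
  ; present = updateAt-updates v X
  ; agree   = λ i i≢v → updateAt-minimal i v X i≢v
  }

removal : ∀ {n} {X : Fin n → Bool} {v} → X v ≡ true → Insertion (updateAt X v (λ _ → false)) v X
removal {X = X} {v} Xv = record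
  { absent  = updateAt-updates v X
  ; present = Xv
  ; agree   = λ i i≢v → sym (updateAt-minimal i v X i≢v)
  }

card-insertion : ∀ {n} {X Y : Fin n → Bool} {v} → Insertion X v Y → card Y ≡ suc (card X)
card-insertion {X = X} {Y} {v} ins
  with sum-update {f = 𝟙 ∘ Y} {g = 𝟙 ∘ X} v (λ i i≢v → cong 𝟙 (agree ins i i≢v))
... | eq rewrite present ins | absent ins = sym eq

module _ {A : Set} where

  prefix : ∀ {y : A} {zs} → y ∈ zs → List A
  prefix {zs = z ∷ _} (here _)  = z ∷ []
  prefix {zs = z ∷ _} (there m) = z ∷ prefix m

  prefix-nonempty : ∀ {y : A} {zs} (m : y ∈ zs) → 1 ≤ length (prefix m)
  prefix-nonempty (here _)  = s≤s z≤n
  prefix-nonempty (there _) = s≤s z≤n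

  All-prefix : ∀ {P : A → Set} {y zs} → All P zs → (m : y ∈ zs) → All P (prefix m)
  All-prefix (pz ∷ _)   (here _)  = pz ∷ []
  All-prefix (pz ∷ pzs) (there m) = pz ∷ All-prefix pzs m

  Unique-prefix : ∀ {y zs} → Unique zs → (m : y ∈ zs) → Unique (prefix m)
  Unique-prefix (_ ∷ _)      (here _)  = [] ∷ []
  Unique-prefix (z∉ ∷ uniq) (there m) = All-prefix z∉ m ∷ Unique-prefix uniq m

  Linked-prefix-∷ʳ : ∀ {R : A → A → Set} {w y x zs} →
                     Linked R (w ∷ zs) → (m : y ∈ zs) → R y x → Linked R ((w ∷ prefix m) ∷ʳ x)
  Linked-prefix-∷ʳ (wz ∷ _)  (here refl) yx = wz ∷ yx ∷ [-]
  Linked-prefix-∷ʳ (wz ∷ zs) (there m)   yx = wz ∷ Linked-prefix-∷ʳ zs m yx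

_≺_ : ∀ {n} → Fin n → Fin n → Bool
i ≺ j = toℕ i <ᵇ toℕ j

module _ {n : ℕ} (G : Graph n) where

  inducedEdge : (Fin n → Bool) → Fin n → Fin n → Bool
  inducedEdge X i j = i ≺ j ∧ X i ∧ X j ∧ adj G i j

  edges : (Fin n → Bool) → ℕ
  edges X = sum λ i → sum λ j → 𝟙 (inducedEdge X i j)

  degree : (Fin n → Bool) → Fin n → ℕ
  degree X v = sum λ j → 𝟙 (X j ∧ adj G v j)

  adjacent⇒≢ : ∀ {u v} → Adj G u v → u ≢ v
  adjacent⇒≢ {u} uv refl with () ← trans (sym (irrefl G u)) uv

  adjacent-sym : ∀ {u v} → Adj G u v → Adj G v u
  adjacent-sym {u} {v} uv = trans (adj-sym G v u) uv

  edges-cong : ∀ {X Y} → (∀ i → X i ≡ Y i) → edges X ≡ edges Y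
  edges-cong X≗Y = sum-cong-≗ λ i → sum-cong-≗ λ j →
    cong₂ (λ x y → 𝟙 (i ≺ j ∧ x ∧ y ∧ adj G i j)) (X≗Y i) (X≗Y j)

  edges-empty : ∀ {X} → (∀ i → X i ≡ false) → edges X ≡ 0
  edges-empty {X} X≡false = sum-zero λ i → sum-zero λ j → no-edge i j
    where
    no-edge : ∀ i j → 𝟙 (inducedEdge X i j) ≡ 0
    no-edge i j rewrite X≡false i = cong 𝟙 (∧-zeroʳ (i ≺ j))

  degree-≤-card : ∀ X v → degree X v ≤ card X
  degree-≤-card X v = sum-mono-≤ λ j → 𝟙-∧-≤ (X j) (adj G v j)

  degree-≤1 : ∀ {X v} p → (∀ y → X y ∧ adj G v y ≡ true → y ≡ p) → degree X v ≤ 1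
  degree-≤1 {X} {v} p only-p = ≤-trans (≤-reflexive (sum-at p off-p)) (𝟙≤1 _)
    where
    off-p : ∀ y → y ≢ p → 𝟙 (X y ∧ adj G v y) ≡ 0
    off-p y y≢p with X y ∧ adj G v y in eq
    ... | true  = contradiction (only-p y eq) y≢p
    ... | false = refl

  neighbour⇒degree-pos : ∀ {X v u} → X u ≡ true → Adj G v u → 1 ≤ degree X v
  neighbour⇒degree-pos {X} {v} {u} Xu vu =
    ≤-trans (≤-reflexive (sym (cong₂ (λ x a → 𝟙 (x ∧ a)) Xu vu))) (≤-sum (λ j → 𝟙 (X j ∧ adj G v j)) u)

  degree-insertion : ∀ {X Y v} → Insertion X v Y → degree Y v ≡ degree X v
  degree-insertion {X} {Y} {v} ins = sum-cong-≗ same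
    where
    same : ∀ j → 𝟙 (Y j ∧ adj G v j) ≡ 𝟙 (X j ∧ adj G v j)
    same j with j ≟ v
    ... | yes refl rewrite irrefl G j = cong 𝟙 (trans (∧-zeroʳ (Y j)) (sym (∧-zeroʳ (X j))))
    ... | no j≢v   = cong (λ x → 𝟙 (x ∧ adj G v j)) (agree ins j j≢v)

  -- The new edges are those at v; according as v is the smaller or the larger endpoint they are
  -- counted by forward or by backward, and together these count every X-neighbour of v once.
  edges-insertion : ∀ {X Y v} → Insertion X v Y → edges Y ≡ edges X + degree X v
  edges-insertion {X} {Y} {v} ins = begin
    edges Y
      ≡⟨ sum-cong-≗ (λ i → sum-cong-≗ (split i)) ⟩
    sum (λ i → sum λ j → old i j + (out i j + in′ i j))
      ≡⟨ ∑∑-distrib-+ old (λ i j → out i j + in′ i j) ⟩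
    edges X + sum (λ i → sum λ j → out i j + in′ i j)
      ≡⟨ cong (edges X +_) (∑∑-distrib-+ out in′) ⟩
    edges X + (sum (λ i → sum (out i)) + sum (λ i → sum (in′ i)))
      ≡⟨ cong (edges X +_) (cong₂ _+_ (trans (∑-comm out) (sum-cong-≗ λ j → sum-δ v (λ _ → forward j)))
                                       (sum-cong-≗ λ i → sum-δ v (λ _ → backward i))) ⟩
    edges X + (sum (𝟙 ∘ forward) + sum (𝟙 ∘ backward))
      ≡⟨ cong (edges X +_) (trans (sym (∑-distrib-+ (𝟙 ∘ forward) (𝟙 ∘ backward))) (sum-cong-≗ merge)) ⟩
    edges X + degree X v
      ∎
    where
    open ≡-Reasoning
    forward backward : Fin n → Bool
    forward  j = v ≺ j ∧ X j ∧ adj G v j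
    backward i = i ≺ v ∧ X i ∧ adj G i v

    old out in′ : Fin n → Fin n → ℕ
    old i j = 𝟙 (inducedEdge X i j)
    out i j = 𝟙 (does (i ≟ v) ∧ forward j)
    in′ i j = 𝟙 (does (j ≟ v) ∧ backward i)

    -- Stated unfolded, so that `with` can abstract over i ≟ v and j ≟ v.
    split : ∀ i j → 𝟙 (inducedEdge Y i j) ≡
            𝟙 (inducedEdge X i j) + (𝟙 (does (i ≟ v) ∧ forward j) + 𝟙 (does (j ≟ v) ∧ backward i))
    split i j with i ≟ v | j ≟ v
    ... | yes refl | yes refl rewrite absent ins | present ins | irrefl G i | ∧-zeroʳ (i ≺ i) = refl
    ... | yes refl | no j≢v   rewrite absent ins | present ins | agree ins j j≢v | ∧-zeroʳ (i ≺ j) =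
      sym (+-identityʳ _)
    ... | no i≢v   | yes refl rewrite absent ins | present ins | agree ins i i≢v
                                   | ∧-zeroʳ (X i) | ∧-zeroʳ (i ≺ j) = refl
    ... | no i≢v   | no j≢v   rewrite agree ins i i≢v | agree ins j j≢v = sym (+-identityʳ _)

    merge : ∀ j → 𝟙 (forward j) + 𝟙 (backward j) ≡ 𝟙 (X j ∧ adj G v j)
    merge j rewrite adj-sym G j v = 𝟙-∧-xor (v ≺ j) (j ≺ v) (X j ∧ adj G v j) λ edge →
      <ᵇ-xor (adjacent⇒≢ (∧-conicalʳ (X j) _ edge) ∘ toℕ-injective)

  IsPath : List (Fin n) → Set
  IsPath xs = Unique xs × Linked (Adj G) xs

  path-∷ : ∀ {y x rest} → IsPath (x ∷ rest) → Adj G y x → y ∉ x ∷ rest → IsPath (y ∷ x ∷ rest)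
  path-∷ (unique , linked) yx y∉ = ¬Any⇒All¬ _ y∉ ∷ unique , yx ∷ linked

  chord⇒cycle : ∀ {x p rest y} → IsPath (x ∷ p ∷ rest) → Adj G y x → (m : y ∈ rest) →
                IsCycle G x (p ∷ prefix m)
  chord⇒cycle (x∉ ∷ unique , linked) yx m =
    s≤s (s≤s (prefix-nonempty m)) ,
    All-prefix x∉ (there m) ∷ Unique-prefix unique (there m) ,
    Linked-prefix-∷ʳ linked (there m) yx

  previous : Fin n → List (Fin n) → Fin n
  previous x []      = x
  previous _ (p ∷ _) = p

  neighbour-on-path : Acyclic G → ∀ {x rest y} → IsPath (x ∷ rest) → Adj G x y → y ∈ x ∷ rest →
                      y ≡ previous x rest
  neighbour-on-path _ _ xy (here refl) = contradiction refl (adjacent⇒≢ xy)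
  neighbour-on-path _ _ _ (there (here refl)) = refl
  neighbour-on-path acyclic path xy (there (there m)) =
    ⊥-elim (acyclic _ _ (chord⇒cycle path (adjacent-sym xy) m))

  open import Data.List.Membership.DecPropositional (_≟_ {n}) using (_∈?_)

  offPath : List (Fin n) → Fin n → Bool
  offPath xs i = not (does (i ∈? xs))

  offPath-insertion : ∀ {y xs} → y ∉ xs → Insertion (offPath (y ∷ xs)) y (offPath xs)
  offPath-insertion {y} {xs} y∉ = record
    { absent  = cong not (dec-true (y ∈? y ∷ xs) (here refl))
    ; present = cong not (dec-false (y ∈? xs) y∉)
    ; agree   = agree′
    }
    where
    agree′ : ∀ i → i ≢ y → offPath xs i ≡ offPath (y ∷ xs) i
    agree′ i i≢y rewrite dec-false (i ≟ y) i≢y = refl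

  module _ (acyclic : Acyclic G) (X : Fin n → Bool) where

    LowDegreeVertex : Set
    LowDegreeVertex = ∃[ v ] X v ≡ true × degree X v ≤ 1

    -- Extend a path at its head while the head has an X-neighbour off the path; the fuel k
    -- bounds the number of vertices off the path. Once stuck, every X-neighbour of the head lies
    -- on the path and so, G being acyclic, is its predecessor.
    low-degree-vertex-along : ∀ k x rest → X x ≡ true → IsPath (x ∷ rest) →
                              card (offPath (x ∷ rest)) < k → LowDegreeVertex
    low-degree-vertex-along (suc k) x rest Xx path fuel
      with any? (λ y → (X y Bool.≟ true) ×-dec (adj G x y Bool.≟ true) ×-dec ¬? (y ∈? x ∷ rest))
    ... | yes (y , Xy , xy , y∉) =
      low-degree-vertex-along k y (x ∷ rest) Xy (path-∷ path (adjacent-sym xy) y∉)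
        (<-≤-trans (≤-reflexive (sym (card-insertion (offPath-insertion y∉)))) (s≤s⁻¹ fuel))
    ... | no ∄fresh = x , Xx , degree-≤1 (previous x rest) λ y Xy∧xy →
      neighbour-on-path acyclic path (∧-conicalʳ _ _ Xy∧xy)
        (decidable-stable (y ∈? x ∷ rest) λ y∉ →
          ∄fresh (y , ∧-conicalˡ _ _ Xy∧xy , ∧-conicalʳ _ _ Xy∧xy , y∉))

    low-degree-vertex : ∀ {s} → X s ≡ true → LowDegreeVertex
    low-degree-vertex {s} Xs = low-degree-vertex-along _ s [] Xs ([] ∷ [] , [-]) (n<1+n _)

  acyclic-edges : Acyclic G → ∀ k X → card X ≡ k → edges X ≤ k ∸ 1
  acyclic-edges acyclic k X |X|≡k with constant-or-witness X false
  ... | inj₁ X≡false = ≤-trans (≤-reflexive (edges-empty X≡false)) z≤n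
  ... | inj₂ (s , Xs) with low-degree-vertex acyclic X Xs
  ...   | x , Xx , deg≤1 with k
  ...     | zero  = contradiction (trans (sym (card-insertion (removal {X = X} Xx))) |X|≡k) λ ()
  ...     | suc k = begin
    edges X                ≡⟨ edges-insertion ins ⟩
    edges X′ + degree X′ x ≤⟨ +-monoˡ-≤ (degree X′ x) (acyclic-edges acyclic k X′ |X′|≡k) ⟩
    k ∸ 1 + degree X′ x    ≤⟨ m∸1+n≤m deg≤k deg′≤1 ⟩
    k                      ∎
    where
    open ≤-Reasoning
    X′ : Fin n → Bool
    X′ = updateAt X x (λ _ → false)
    ins : Insertion X′ x X
    ins = removal Xx
    |X′|≡k : card X′ ≡ k
    |X′|≡k = suc-injective (trans (sym (card-insertion ins)) |X|≡k)
    deg≤k : degree X′ x ≤ k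
    deg≤k = ≤-trans (degree-≤-card X′ x) (≤-reflexive |X′|≡k)
    deg′≤1 : degree X′ x ≤ 1
    deg′≤1 = ≤-trans (≤-reflexive (sym (degree-insertion ins))) deg≤1

  walk-exits : ∀ {X : Fin n → Bool} {x y} → Walk G x y → X x ≡ true → X y ≡ false →
               ∃[ u ] ∃[ v ] X u ≡ true × X v ≡ false × Adj G u v
  walk-exits here Xx Xy with () ← trans (sym Xx) Xy
  walk-exits {X} (step {v = v} xv walk) Xx Xy with X v in Xv
  ... | true  = walk-exits walk Xv Xy
  ... | false = _ , v , Xx , Xv , xv

  -- k counts the vertices outside X; a walk from r to one of them leaves X along some edge,
  -- and adding its outer endpoint to X gains at least that edge.
  connected-edges-from : Connected G → ∀ r k X → X r ≡ true → k + card X ≡ n →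
                         k + edges X ≤ edges (λ _ → true)
  connected-edges-from connected r k X Xr k+|X|≡n with constant-or-witness X true | k
  ... | inj₁ X≡true | zero  = ≤-reflexive (edges-cong X≡true)
  ... | inj₁ X≡true | suc k =
    contradiction (subst (λ c → suc k + c ≡ n) (card-all-true X≡true) k+|X|≡n) (m≢1+n+m n ∘ sym)
  ... | inj₂ (w , Xw) | zero = contradiction (subst (_≤ n) |Y|≡1+n (card-≤ _)) (n≮n n)
    where
    |Y|≡1+n : card (updateAt X w (λ _ → true)) ≡ suc n
    |Y|≡1+n = trans (card-insertion (insertion {X = X} Xw)) (cong suc k+|X|≡n)
  ... | inj₂ (w , Xw) | suc k with walk-exits (connected r w) Xr Xw
  ...   | u , v , Xu , Xv , uv = begin
    suc k + edges X   ≡⟨ +-suc k (edges X) ⟨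
    k + suc (edges X) ≤⟨ +-monoʳ-≤ k edges-grow ⟩
    k + edges Y       ≤⟨ connected-edges-from connected r k Y (⊆-insertion ins Xr) k+|Y|≡n ⟩
    edges (λ _ → true) ∎
    where
    open ≤-Reasoning
    Y : Fin n → Bool
    Y = updateAt X v (λ _ → true)
    ins : Insertion X v Y
    ins = insertion Xv
    edges-grow : suc (edges X) ≤ edges Y
    edges-grow = begin
      suc (edges X)         ≡⟨ +-comm 1 (edges X) ⟩
      edges X + 1           ≤⟨ +-monoʳ-≤ (edges X) (neighbour⇒degree-pos Xu (adjacent-sym uv)) ⟩
      edges X + degree X v  ≡⟨ edges-insertion ins ⟨
      edges Y               ∎
    k+|Y|≡n : k + card Y ≡ n
    k+|Y|≡n = trans (cong (k +_) (card-insertion ins)) (trans (+-suc k (card X)) k+|X|≡n)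

  connected-edges : Connected G → 1 ≤ n → n ∸ 1 ≤ edges (λ _ → true)
  connected-edges connected 1≤n =
    ≤-trans (m≤m+n (n ∸ 1) _) (connected-edges-from connected r (n ∸ 1) ⁅r⁆ (present ins) n∸1+|⁅r⁆|≡n)
    where
    r : Fin n
    r = fromℕ< 1≤n
    ⁅r⁆ : Fin n → Bool
    ⁅r⁆ = updateAt (λ _ → false) r (λ _ → true)
    ins : Insertion (λ _ → false) r ⁅r⁆
    ins = insertion refl
    |⁅r⁆|≡1 : card ⁅r⁆ ≡ 1
    |⁅r⁆|≡1 = trans (card-insertion ins) (cong suc (sum-zero {n} λ _ → refl))
    n∸1+|⁅r⁆|≡n : n ∸ 1 + card ⁅r⁆ ≡ n
    n∸1+|⁅r⁆|≡n = trans (cong (n ∸ 1 +_) |⁅r⁆|≡1) (m∸n+n≡m 1≤n)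

fromℚᵘ-mono-≤ : ∀ {p q} → p ℚᵘ.≤ q → fromℚᵘ p ℚ.≤ fromℚᵘ q
fromℚᵘ-mono-≤ {p} {q} p≤q = toℚᵘ-cancel-≤
  (ℚᵘ.≤-respˡ-≃ (ℚᵘ.≃-sym (toℚᵘ-fromℚᵘ p)) (ℚᵘ.≤-respʳ-≃ (ℚᵘ.≃-sym (toℚᵘ-fromℚᵘ q)) p≤q))

frac-≤ : ∀ {a c k m} → a * suc m ≤ c * suc k → frac a (suc k) ℚ.≤ frac c (suc m)
frac-≤ {a} {c} {k} {m} cross = fromℚᵘ-mono-≤ {mkℚᵘ (ℤ.+ a) k} {mkℚᵘ (ℤ.+ c) m}
  (ℚᵘ.*≤* (subst₂ ℤ._≤_ (ℤ.pos-* a (suc m)) (ℤ.pos-* c (suc k)) (ℤ.+≤+ cross)))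

*-suc-cross : ∀ {k m} → k ≤ m → k * suc m ≤ m * suc k
*-suc-cross {k} {m} k≤m = begin
  k * suc m ≡⟨ *-suc k m ⟩
  k + k * m ≤⟨ +-monoˡ-≤ (k * m) k≤m ⟩
  m + k * m ≡⟨ cong (m +_) (*-comm k m) ⟩
  m + m * k ≡⟨ *-suc m k ⟨
  m * suc k ∎
  where open ≤-Reasoning

average-degree-≤ : ∀ {e k E m} → e ≤ k ∸ 1 → m ∸ 1 ≤ E → k ≤ m → frac (2 * e) k ℚ.≤ frac (2 * E) m
average-degree-≤ {k = zero} {m = zero}  _ _ _ = ℚ.≤-refl
average-degree-≤ {k = zero} {E} {suc m} _ _ _ = frac-≤ {0} {2 * E} {0} {m} z≤n
average-degree-≤ {e} {suc k} {E} {suc m} e≤k m≤E (s≤s k≤m) = frac-≤ {2 * e} {2 * E} (begin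
  2 * e * suc m   ≡⟨ *-assoc 2 e (suc m) ⟩
  2 * (e * suc m) ≤⟨ *-monoʳ-≤ 2 (*-monoˡ-≤ (suc m) e≤k) ⟩
  2 * (k * suc m) ≤⟨ *-monoʳ-≤ 2 (*-suc-cross k≤m) ⟩
  2 * (m * suc k) ≤⟨ *-monoʳ-≤ 2 (*-monoˡ-≤ (suc k) m≤E) ⟩
  2 * (E * suc k) ≡⟨ *-assoc 2 E (suc k) ⟨
  2 * E * suc k   ∎)
  where open ≤-Reasoning

mem-lookup : ∀ {n} (S : Subset n) i → mem S i ≡ lookup S i
mem-lookup S i with lookup S i
... | true  = refl
... | false = refl

size≡card : ∀ {n} (S : Subset n) → ∣ S ∣ ≡ card (mem S)
size≡card S = trans (size-lookup S) (sum-cong-≗ λ i → cong 𝟙 (sym (mem-lookup S i)))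
  where
  size-lookup : ∀ {n} (S : Subset n) → ∣ S ∣ ≡ card (lookup S)
  size-lookup []          = refl
  size-lookup (true ∷ S)  = cong suc (size-lookup S)
  size-lookup (false ∷ S) = size-lookup S

if-𝟙 : ∀ b → (if b then 1 else 0) ≡ 𝟙 b
if-𝟙 true  = refl
if-𝟙 false = refl

module _ {n : ℕ} (G : Graph n) where

  edgesIn≡edges : ∀ S → edgesIn G S ≡ edges G (mem S)
  edgesIn≡edges S = trans (listSum-allFin row) (sum-cong-≗ λ i → trans (listSum-allFin (entry i))
                                                  (sum-cong-≗ λ j → if-𝟙 (inducedEdge G (mem S) i j)))
    where
    entry : Fin n → Fin n → ℕ
    entry i j = if (toℕ i <ᵇ toℕ j) ∧ mem S i ∧ mem S j ∧ adj G i j then 1 else 0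
    row : Fin n → ℕ
    row i = listSum (map (entry i) (allFin n))

  edgesIn-acyclic : Acyclic G → ∀ S → edgesIn G S ≤ ∣ S ∣ ∸ 1
  edgesIn-acyclic acyclic S =
    ≤-trans (≤-reflexive (edgesIn≡edges S)) (acyclic-edges G acyclic ∣ S ∣ (mem S) (sym (size≡card S)))

  edgesIn-connected : Connected G → 1 ≤ n → n ∸ 1 ≤ edgesIn G ⊤
  edgesIn-connected connected 1≤n =
    ≤-trans (connected-edges G connected 1≤n)
            (≤-reflexive (sym (trans (edgesIn≡edges ⊤) (edges-cong G mem-⊤))))
    where
    mem-⊤ : ∀ i → mem ⊤ i ≡ true
    mem-⊤ i = trans (mem-lookup ⊤ i) (lookup-replicate i true)

proposition1 : (n : ℕ) (G : Graph n) → IsTree G → AverageHereditary G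
proposition1 n G (1≤n , connected , acyclic) S =
  subst (λ m → avgDegInduced G S ℚ.≤ frac (2 * edgesIn G ⊤) m) (sym (∣⊤∣≡n n))
    (average-degree-≤ (edgesIn-acyclic G acyclic S) (edgesIn-connected G connected 1≤n) (∣p∣≤n S))
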